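{- Let $N\ge 1$ be an integer and $0<p<1$. Let $f:\{0,1,\dots,N\}\to\mathbb{R}$ satisfy \[ f(x)=\frac{1-p}{2}f(x-1)+\frac{1-p}{2}f(x+1)+p\,f(N-x)\quad\text{for all integers }0<x<N, \] with boundary conditions $f(0)=0$ and $f(N)=1$. Then for every integer $0\le x\le N$, \[ f(x)+f(N-x)=1. \]
   Context: This is the "mirror step" variant of the gambler's ruin: a particle at an integer position $x$ with $0<x<N$ moves to $x-1$ with probability $\frac{1-p}{2}$, to $x+1$ with probability $\frac{1-p}{2}$, or to $N-x$ (the mirror step) with probability $p$, and stops upon reaching $0$ or $N$. The function $f(x)$ is the probability that the particle started at $x$ eventually reaches $N$; it is the solution of the stated recurrence with the stated boundary conditions. -}

module Defs where

open import Level using (Level; suc; _⊔_)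
open import Data.Product using (_×_)
open import Relation.Nullary using (¬_)
open import Relation.Binary.Core using (Rel)
open import Relation.Binary.Structures using (IsStrictTotalOrder)
open import Algebra.Bundles using (CommutativeRing)

-- An ordered field (the standard library has neither reals nor fields).
-- ℝ is an instance; the theorem is stated for every ordered field.
-- The inverse is total (value at 0 is junk), as in Lean/Mathlib.
record OrderedField (c ℓ₁ ℓ₂ : Level) : Set (suc (c ⊔ ℓ₁ ⊔ ℓ₂)) where
  field
    commutativeRing : CommutativeRing c ℓ₁
  open CommutativeRing commutativeRing public
  infix 4 _<_
  infix 8 _⁻¹
  field
    _<_ : Rel Carrier ℓ₂
    isStrictTotalOrder : IsStrictTotalOrder _≈_ _<_
    +-mono-< : ∀ {x y} z → x < y → x + z < y + z
    *-pos : ∀ {x y} → 0# < x → 0# < y → 0# < x * y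
    _⁻¹ : Carrier → Carrier
    ⁻¹-inverse : ∀ x → ¬ (x ≈ 0#) → x * (x ⁻¹) ≈ 1#
    0≉1 : ¬ (0# ≈ 1#)

-- The mirror x ↦ N - x swaps the two summands of S(x) = f(x) + f(N - x), so adding the
-- equations at x and at N - x shows that S satisfies the same equation with the mirror term
-- p·S(x) in place of p·f(N - x).  Since (1-p)/2 + (1-p)/2 + p = 1, this says that S is
-- harmonic for the simple walk, i.e. an arithmetic progression on [0, N]; as S(0) = S(N)
-- and the field has characteristic zero, S is constant, equal to f(0) + f(N) = 1.
module Submission where

open import Defs
open import Level using (Level)
open import Data.Nat using (ℕ; zero; suc; _∸_; _≤_; z≤n; s≤s) renaming (_<_ to _<ℕ_; _+_ to _+ℕ_)
import Data.Nat.Properties as ℕₚ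
open import Data.Empty using (⊥-elim)
open import Relation.Nullary using (¬_)
open import Relation.Binary.Structures using (IsStrictTotalOrder)
open import Relation.Binary.Definitions using (tri<; tri≈; tri>)
open import Relation.Binary.PropositionalEquality as ≡ using (_≡_)
open import Algebra.Bundles using (CommutativeRing)
import Relation.Binary.Reasoning.Setoid as SetoidReasoning

module HarmonicSequences {r ℓ} (R : CommutativeRing r ℓ) where
  open CommutativeRing R
  open import Algebra.Properties.Ring ring using (+-cancelˡ)
  open import Algebra.Properties.Semiring.Mult semiring using (_×_)
  open import Algebra.Solver.Ring.NaturalCoefficients.Default commutativeSemiring
  open SetoidReasoning setoid

  HarmonicOn : ℕ → (ℕ → Carrier) → Set ℓ
  HarmonicOn N s = ∀ k → 2 +ℕ k ≤ N → s k + s (2 +ℕ k) ≈ s (1 +ℕ k) + s (1 +ℕ k)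

  harmonic⇒constantStep : ∀ {N : ℕ} {s : ℕ → Carrier} {d : Carrier} →
    HarmonicOn N s → s 1 ≈ s 0 + d → ∀ k → suc k ≤ N → s (suc k) ≈ s k + d
  harmonic⇒constantStep h s₁ zero    _      = s₁
  harmonic⇒constantStep {s = s} {d} h s₁ (suc k) 2+k≤N = +-cancelˡ (s k) _ _ (begin
    s k + s (2 +ℕ k)          ≈⟨ h k 2+k≤N ⟩
    s (1 +ℕ k) + s (1 +ℕ k)   ≈⟨ +-congˡ (harmonic⇒constantStep h s₁ k (ℕₚ.<⇒≤ 2+k≤N)) ⟩
    s (1 +ℕ k) + (s k + d)    ≈⟨ solve 3 (λ u v d → u :+ (v :+ d) := v :+ (u :+ d)) refl (s (1 +ℕ k)) (s k) d ⟩
    s k + (s (1 +ℕ k) + d)    ∎)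

  constantStep⇒arithmetic : ∀ {N : ℕ} {s : ℕ → Carrier} {d : Carrier} →
    (∀ k → suc k ≤ N → s (suc k) ≈ s k + d) → ∀ k → k ≤ N → s k ≈ s 0 + k × d
  constantStep⇒arithmetic {s = s} step zero    _       = sym (+-identityʳ (s 0))
  constantStep⇒arithmetic {s = s} {d} step (suc k) 1+k≤N = begin
    s (suc k)          ≈⟨ step k 1+k≤N ⟩
    s k + d            ≈⟨ +-congʳ (constantStep⇒arithmetic step k (ℕₚ.<⇒≤ 1+k≤N)) ⟩
    s 0 + k × d + d    ≈⟨ solve 3 (λ s₀ d kd → s₀ :+ kd :+ d := s₀ :+ (d :+ kd)) refl (s 0) d (k × d) ⟩
    s 0 + suc k × d    ∎

module MirrorStep {r ℓ} (R : CommutativeRing r ℓ) where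
  open CommutativeRing R
  open import Algebra.Solver.Ring.NaturalCoefficients.Default commutativeSemiring
  open SetoidReasoning setoid

  MirrorStepEquation : ℕ → Carrier → Carrier → (ℕ → Carrier) → Set ℓ
  MirrorStepEquation N a p f = ∀ x → 0 <ℕ x → x <ℕ N →
    f x ≈ a * f (x ∸ 1) + a * f (x +ℕ 1) + p * f (N ∸ x)

  mirrorSum : ℕ → (ℕ → Carrier) → ℕ → Carrier
  mirrorSum N f x = f x + f (N ∸ x)

  mirrorSum-endpoints : ∀ N f → mirrorSum N f N ≈ mirrorSum N f 0
  mirrorSum-endpoints N f = begin
    f N + f (N ∸ N)   ≡⟨ ≡.cong (λ n → f N + f n) (ℕₚ.n∸n≡0 N) ⟩
    f N + f 0         ≈⟨ +-comm (f N) (f 0) ⟩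
    f 0 + f N         ∎

  mirrorSum-equation : ∀ {N a p f} → MirrorStepEquation N a p f → ∀ k → 2 +ℕ k ≤ N →
    mirrorSum N f (1 +ℕ k) ≈ a * (mirrorSum N f k + mirrorSum N f (2 +ℕ k)) + p * mirrorSum N f (1 +ℕ k)
  mirrorSum-equation {N} {a} {p} {f} equation k 2+k≤N = begin
    f x + f y
      ≈⟨ +-cong (equationAt (s≤s z≤n) 2+k≤N ≡.refl (ℕₚ.+-comm x 1) ≡.refl)
                (equationAt (ℕₚ.m<n⇒0<n∸m 2+k≤N) (ℕₚ.∸-monoʳ-< (s≤s z≤n) x≤N)
                            y∸1≡N∸[2+k] y+1≡N∸k (ℕₚ.m∸[m∸n]≡n x≤N)) ⟩
    (a * f k + a * f (2 +ℕ k) + p * f y) + (a * f (N ∸ (2 +ℕ k)) + a * f (N ∸ k) + p * f x)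
      ≈⟨ solve 8 (λ a p u v w u′ v′ w′ → (a :* u :+ a :* v :+ p :* w′) :+ (a :* v′ :+ a :* u′ :+ p :* w)
                                        := a :* ((u :+ u′) :+ (v :+ v′)) :+ p :* (w :+ w′))
               refl a p (f k) (f (2 +ℕ k)) (f x) (f (N ∸ k)) (f (N ∸ (2 +ℕ k))) (f y) ⟩
    a * (mirrorSum N f k + mirrorSum N f (2 +ℕ k)) + p * (f x + f y) ∎
    where
    x y : ℕ
    x = 1 +ℕ k
    y = N ∸ x

    x≤N : x ≤ N
    x≤N = ℕₚ.<⇒≤ 2+k≤N

    equationAt : ∀ {z l r m} → 0 <ℕ z → z <ℕ N → z ∸ 1 ≡ l → z +ℕ 1 ≡ r → N ∸ z ≡ m →
                 f z ≈ a * f l + a * f r + p * f m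
    equationAt 0<z z<N ≡.refl ≡.refl ≡.refl = equation _ 0<z z<N

    y∸1≡N∸[2+k] : y ∸ 1 ≡ N ∸ (2 +ℕ k)
    y∸1≡N∸[2+k] = ≡.trans (ℕₚ.∸-+-assoc N x 1) (≡.cong (N ∸_) (ℕₚ.+-comm x 1))

    y+1≡N∸k : y +ℕ 1 ≡ N ∸ k
    y+1≡N∸k = ≡.trans (ℕₚ.+-comm y 1) (≡.sym (ℕₚ.+-∸-assoc 1 x≤N))

module OrderedFieldProperties {c ℓ₁ ℓ₂ : Level} (F : OrderedField c ℓ₁ ℓ₂) where
  open OrderedField F
  open IsStrictTotalOrder isStrictTotalOrder
    using (compare; irrefl; <-respʳ-≈; <-respˡ-≈) renaming (trans to <-trans)
  open import Algebra.Properties.Ring ring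
    using (+-cancelʳ; +-identityʳ-unique; \\-leftDividesˡ; //-rightDividesˡ; -1*x≈-x; -‿involutive)
  open import Algebra.Properties.Semiring.Mult semiring using (_×_; ×-congʳ; ×-assoc-*)
  open import Algebra.Solver.Ring.NaturalCoefficients.Default commutativeSemiring
  open SetoidReasoning setoid
  open HarmonicSequences commutativeRing
  open MirrorStep commutativeRing

  0<1 : 0# < 1#
  0<1 with compare 0# 1#
  ... | tri< 0<1 _ _ = 0<1
  ... | tri≈ _ 0≈1 _ = ⊥-elim (0≉1 0≈1)
  ... | tri> _ _ 1<0 = ⊥-elim (irrefl refl (<-trans 0<1′ 1<0))
    where
    0<-1 : 0# < - 1#
    0<-1 = <-respʳ-≈ (+-identityˡ (- 1#)) (<-respˡ-≈ (-‿inverseʳ 1#) (+-mono-< (- 1#) 1<0))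
    0<1′ : 0# < 1#
    0<1′ = <-respʳ-≈ (trans (-1*x≈-x (- 1#)) (-‿involutive 1#)) (*-pos 0<-1 0<-1)

  +-pos : ∀ {x y} → 0# < x → 0# < y → 0# < x + y
  +-pos {x} {y} 0<x 0<y = <-trans 0<y (<-respˡ-≈ (+-identityˡ y) (+-mono-< y 0<x))

  >0⇒≉0 : ∀ {x} → 0# < x → ¬ x ≈ 0#
  >0⇒≉0 0<x x≈0 = irrefl (sym x≈0) 0<x

  *-cancelˡ : ∀ {x y z} → ¬ x ≈ 0# → x * y ≈ x * z → y ≈ z
  *-cancelˡ {x} {y} {z} x≉0 xy≈xz = begin
    y                ≈⟨ x⁻¹*[x*w]≈w y ⟨
    x ⁻¹ * (x * y)   ≈⟨ *-congˡ xy≈xz ⟩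
    x ⁻¹ * (x * z)   ≈⟨ x⁻¹*[x*w]≈w z ⟩
    z                ∎
    where
    x⁻¹*[x*w]≈w : ∀ w → x ⁻¹ * (x * w) ≈ w
    x⁻¹*[x*w]≈w w = begin
      x ⁻¹ * (x * w)   ≈⟨ *-assoc (x ⁻¹) x w ⟨
      x ⁻¹ * x * w     ≈⟨ *-congʳ (trans (*-comm (x ⁻¹) x) (⁻¹-inverse x x≉0)) ⟩
      1# * w           ≈⟨ *-identityˡ w ⟩
      w                ∎

  suc×1>0 : ∀ n → 0# < suc n × 1#
  suc×1>0 zero    = <-respʳ-≈ (sym (+-identityʳ 1#)) 0<1
  suc×1>0 (suc n) = +-pos 0<1 (suc×1>0 n)

  ×≈×1* : ∀ n x → n × x ≈ (n × 1#) * x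
  ×≈×1* n x = sym (trans (×-assoc-* n 1# x) (×-congʳ n (*-identityˡ x)))

  suc×x≈0⇒x≈0 : ∀ n {x} → suc n × x ≈ 0# → x ≈ 0#
  suc×x≈0⇒x≈0 n {x} nx≈0 =
    *-cancelˡ (>0⇒≉0 (suc×1>0 n)) (trans (sym (×≈×1* (suc n) x)) (trans nx≈0 (sym (zeroʳ _))))

  harmonic⇒constant : ∀ {N s} → HarmonicOn N s → s N ≈ s 0 → ∀ k → k ≤ N → s k ≈ s 0
  harmonic⇒constant {zero}  _ _ zero z≤n = refl
  harmonic⇒constant {suc n} {s} harmonic sN≈s0 k k≤N = begin
    s k                  ≈⟨ arithmetic k k≤N ⟩
    s 0 + k × d          ≈⟨ +-congˡ (×≈×1* k d) ⟩
    s 0 + (k × 1#) * d   ≈⟨ +-congˡ (*-congˡ d≈0) ⟩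
    s 0 + (k × 1#) * 0#  ≈⟨ +-congˡ (zeroʳ _) ⟩
    s 0 + 0#             ≈⟨ +-identityʳ (s 0) ⟩
    s 0                  ∎
    where
    d : Carrier
    d = - s 0 + s 1

    arithmetic : ∀ k → k ≤ suc n → s k ≈ s 0 + k × d
    arithmetic = constantStep⇒arithmetic (harmonic⇒constantStep harmonic (sym (\\-leftDividesˡ (s 0) (s 1))))

    d≈0 : d ≈ 0#
    d≈0 = suc×x≈0⇒x≈0 n (+-identityʳ-unique (s 0) _ (trans (sym (arithmetic (suc n) ℕₚ.≤-refl)) sN≈s0))

  half : Carrier → Carrier
  half x = x * (1# + 1#) ⁻¹

  half+half : ∀ x → half x + half x ≈ x
  half+half x = begin
    x * h + x * h        ≈⟨ distribˡ x h h ⟨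
    x * (h + h)          ≈⟨ *-congˡ (trans (distribʳ h 1# 1#) (+-cong (*-identityˡ h) (*-identityˡ h))) ⟨
    x * ((1# + 1#) * h)  ≈⟨ *-congˡ (⁻¹-inverse (1# + 1#) (>0⇒≉0 (+-pos 0<1 0<1))) ⟩
    x * 1#               ≈⟨ *-identityʳ x ⟩
    x                    ∎
    where
    h : Carrier
    h = (1# + 1#) ⁻¹

  x≈a*y+p*x⇒y≈x+x : ∀ {a p x y} → a + a + p ≈ 1# → ¬ a ≈ 0# → x ≈ a * y + p * x → y ≈ x + x
  x≈a*y+p*x⇒y≈x+x {a} {p} {x} {y} a+a+p≈1 a≉0 x≈ay+px =
    *-cancelˡ a≉0 (+-cancelʳ (p * x) _ _ (begin
      a * y + p * x        ≈⟨ x≈ay+px ⟨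
      x                    ≈⟨ *-identityˡ x ⟨
      1# * x               ≈⟨ *-congʳ a+a+p≈1 ⟨
      (a + a + p) * x      ≈⟨ solve 3 (λ a p x → (a :+ a :+ p) :* x := a :* (x :+ x) :+ p :* x) refl a p x ⟩
      a * (x + x) + p * x  ∎))

  mirrorSum-harmonic : ∀ {N p f} → p < 1# →
    MirrorStepEquation N (half (1# - p)) p f → HarmonicOn N (mirrorSum N f)
  mirrorSum-harmonic {p = p} p<1 equation k 2+k≤N =
    x≈a*y+p*x⇒y≈x+x a+a+p≈1 a≉0 (mirrorSum-equation equation k 2+k≤N)
    where
    a : Carrier
    a = half (1# - p)

    a+a+p≈1 : a + a + p ≈ 1#
    a+a+p≈1 = trans (+-congʳ (half+half (1# - p))) (//-rightDividesˡ p 1#)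

    a≉0 : ¬ a ≈ 0#
    a≉0 a≈0 = irrefl p≈1 p<1
      where
      p≈1 : p ≈ 1#
      p≈1 = begin
        p            ≈⟨ +-identityˡ p ⟨
        0# + p       ≈⟨ +-congʳ (+-identityʳ 0#) ⟨
        0# + 0# + p  ≈⟨ +-congʳ (+-cong a≈0 a≈0) ⟨
        a + a + p    ≈⟨ a+a+p≈1 ⟩
        1#           ∎

open OrderedField {{...}} using (Carrier; _≈_; _+_; _*_; _-_; _⁻¹; _<_; 0#; 1#)

mainTheorem1 : ∀ {c ℓ₁ ℓ₂ : Level} {{F : OrderedField c ℓ₁ ℓ₂}} →
    (N : ℕ) → 1 ≤ N → (p : Carrier) → 0# < p → p < 1# →
    (f : ℕ → Carrier) →
    (∀ (x : ℕ) → 0 <ℕ x → x <ℕ N →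
      f x ≈ ((1# - p) * (1# + 1#) ⁻¹) * f (x ∸ 1)
            + ((1# - p) * (1# + 1#) ⁻¹) * f (x +ℕ 1)
            + p * f (N ∸ x)) →
    f 0 ≈ 0# → f N ≈ 1# →
    ∀ (x : ℕ) → x ≤ N → f x + f (N ∸ x) ≈ 1#
mainTheorem1 {{F}} N _ p _ p<1 f equation f0≈0 fN≈1 x x≤N = begin
  f x + f (N ∸ x)   ≈⟨ harmonic⇒constant (mirrorSum-harmonic p<1 equation) (mirrorSum-endpoints N f) x x≤N ⟩
  f 0 + f N         ≈⟨ +-cong f0≈0 fN≈1 ⟩
  0# + 1#           ≈⟨ +-identityˡ 1# ⟩
  1#                ∎
  where
  open OrderedField F using (+-cong; +-identityˡ; setoid)
  open OrderedFieldProperties F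
  open MirrorStep (OrderedField.commutativeRing F)
  open SetoidReasoning setoid
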